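{- Let $(G,\bm{\gamma})$ be a $\mathbb{Z}/3\mathbb{Z}$-colored graph and $\tilde{G}$ its development. If $\tilde{G}$ is Laman-sparse, then $(G,\bm{\gamma})$ is cone-Laman-sparse.
   Context: A $\mathbb{Z}/3\mathbb{Z}$-colored graph is a finite directed (multi)graph $G=(V,E)$ with an element $\gamma_{ij}\in\mathbb{Z}/3\mathbb{Z}$ for each edge $ij$. For a cycle $C$ with a traversal order, $\rho(C)=\sum_{\text{forward}}\gamma_{ij}-\sum_{\text{backward}}\gamma_{ij}$; a subgraph has trivial image if $\rho(C)=0$ for every cycle in it, non-trivial otherwise. For a subgraph, $n'$ is the number of vertices it spans, $m'$ its number of edges. $(G,\bm{\gamma})$ is cone-Laman-sparse if every non-empty subgraph with trivial image has $m'\le 2n'-3$ and every one with non-trivial image has $m'\le 2n'-1$. A graph is Laman-sparse if every non-empty subgraph has $m'\le 2n'-3$. The development $\tilde G$ has vertices $i_0,i_1,i_2$ for each $i\in V$ and, for each directed edge $ij$, the undirected edges $i_tj_{t+\gamma_{ij}}$, $t\in\{0,1,2\}$ (mod 3). -}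

module Defs where

open import Data.Nat using (ℕ; zero; suc; _+_; _*_; _≤_)
open import Data.Nat.DivMod using (_%_; m%n<n)
open import Data.Fin using (Fin; toℕ; fromℕ<; combine; remQuot; _≟_)
open import Data.Bool using (Bool; true; false; if_then_else_; _∧_; _∨_)
open import Data.List using (List; map; allFin)
open import Data.Nat.ListAction using (sum)
open import Data.Bool.ListAction using (any)
open import Relation.Nullary using (¬_)
open import Data.Product using (Σ; _×_; _,_; ∃)
open import Data.Integer using (ℤ; +_; -_)
import Data.Integer as ℤ
open import Data.Integer.Divisibility using () renaming (_∣_ to _∣ℤ_)
open import Relation.Binary.PropositionalEquality using (_≡_)
open import Relation.Nullary.Decidable using (isYes)
open import Function.Definitions using (Injective)

_⊕₃_ : Fin 3 → Fin 3 → Fin 3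
a ⊕₃ b = fromℕ< (m%n<n (toℕ a + toℕ b) 3)

-- A finite directed multigraph (loops and parallel edges allowed):
-- vertices Fin nV, edges Fin nE, edge e goes from src e to tgt e.
record MultiGraph : Set where
  field
    nV  : ℕ
    nE  : ℕ
    src : Fin nE → Fin nV
    tgt : Fin nE → Fin nV
open MultiGraph public

record ColoredGraph : Set where
  field
    graph : MultiGraph
    γ     : Fin (nE graph) → Fin 3
open ColoredGraph public

countB : ∀ {k} → (Fin k → Bool) → ℕ
countB {k} f = sum (map (λ i → if f i then 1 else 0) (allFin k))

-- Subgraphs are given by their (non-empty) edge sets
EdgeSet : MultiGraph → Set
EdgeSet G = Fin (nE G) → Bool

NonEmpty : ∀ {G} → EdgeSet G → Set
NonEmpty S = ∃ λ e → S e ≡ true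

mSub : ∀ {G} → EdgeSet G → ℕ
mSub S = countB S

spans : (G : MultiGraph) → EdgeSet G → Fin (nV G) → Bool
spans G S v = any (λ e → S e ∧ (isYes (src G e ≟ v) ∨ isYes (tgt G e ≟ v))) (allFin (nE G))

nSpan : (G : MultiGraph) → EdgeSet G → ℕ
nSpan G S = countB (spans G S)

LamanSparse : MultiGraph → Set
LamanSparse G = (S : EdgeSet G) → NonEmpty {G} S → mSub {G} S + 3 ≤ 2 * nSpan G S

next : ∀ {k} → Fin (suc k) → Fin (suc k)
next {k} i = fromℕ< (m%n<n (suc (toℕ i)) (suc k))

-- A cycle of length (suc k) in G with a traversal order: distinct vertices
-- v₀,…,v_k, distinct edges e₀,…,e_k, where e_i joins v_i and v_{i+1 mod (k+1)},
-- traversed forward (dir i = true: e_i directed v_i → v_{i+1}) or backward.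
record Cycle (G : MultiGraph) : Set where
  field
    k     : ℕ
    vs    : Fin (suc k) → Fin (nV G)
    es    : Fin (suc k) → Fin (nE G)
    dir   : Fin (suc k) → Bool
    vs-inj : Injective _≡_ _≡_ vs
    es-inj : Injective _≡_ _≡_ es
    fwd   : ∀ i → dir i ≡ true  → (src G (es i) ≡ vs i) × (tgt G (es i) ≡ vs (next i))
    bwd   : ∀ i → dir i ≡ false → (src G (es i) ≡ vs (next i)) × (tgt G (es i) ≡ vs i)
open Cycle public

-- ρ(C) as an integer (its class mod 3 is the element of ℤ/3ℤ)
ρ : (Gγ : ColoredGraph) → Cycle (graph Gγ) → ℤ
ρ Gγ C = Data.List.foldr ℤ._+_ (+ 0)
  (map (λ i → if dir C i then + toℕ (γ Gγ (es C i)) else - (+ toℕ (γ Gγ (es C i))))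
       (allFin (suc (k C))))

CycleIn : ∀ {G} → EdgeSet G → Cycle G → Set
CycleIn S C = ∀ i → S (es C i) ≡ true

TrivialImage : (Gγ : ColoredGraph) → EdgeSet (graph Gγ) → Set
TrivialImage Gγ S = (C : Cycle (graph Gγ)) → CycleIn {graph Gγ} S C → (+ 3) ∣ℤ ρ Gγ C

ConeLamanSparse : ColoredGraph → Set
ConeLamanSparse Gγ = (S : EdgeSet (graph Gγ)) → NonEmpty {graph Gγ} S →
  (TrivialImage Gγ S → mSub {graph Gγ} S + 3 ≤ 2 * nSpan (graph Gγ) S) ×
  (¬ TrivialImage Gγ S → mSub {graph Gγ} S + 1 ≤ 2 * nSpan (graph Gγ) S)

-- development: vertices i_t = combine i t, edges (e,t) joining src(e)_t and tgt(e)_{t+γ(e)}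
development : ColoredGraph → MultiGraph
development Gγ = record
  { nV  = nV G * 3
  ; nE  = nE G * 3
  ; src = λ x → let (e , t) = remQuot 3 x in combine (src G e) t
  ; tgt = λ x → let (e , t) = remQuot 3 x in combine (tgt G e) (t ⊕₃ γ Gγ e)
  }
  where G = graph Gγ

-- Fix a non-empty edge set S of G spanning n vertices with m edges.
--
-- * Non-trivial image (bound m + 1 ≤ 2n): the three copies of every edge of S
--   form a subgraph of the development with 3m edges on at most 3n vertices,
--   so Laman-sparsity gives 3m + 3 ≤ 6n.  This bound in fact holds for every S.
-- * Trivial image (bound m + 3 ≤ 2n): every closed walk in S has colour sum 0,
--   because a closed walk of non-zero colour sum can be shortened, by cutting
--   out detours at repeated vertices, to a cycle of S with ρ ≢ 0 (mod 3).
--   Hence S carries a potential φ : V → ℤ/3ℤ with φ(j) = φ(i) + γᵢⱼ on its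
--   edges, built component by component by a union–find pass over the edges.
--   The copies (e, φ(src e)) of the edges e of S form a "sheet" of the
--   development with m edges on at most n vertices, and Laman-sparsity of the
--   development gives m + 3 ≤ 2n.
module Submission where

open import Defs
open import Data.Nat as ℕ using (ℕ; zero; suc; _+_; _*_; _≤_; _<_; z≤n; s≤s)
import Data.Nat.Properties as ℕP
open import Data.Nat.DivMod using (_%_; m%n<n; m<n⇒m%n≡m; n%n≡0)
open import Data.Nat.ListAction using (sum)
open import Data.Fin as F using (Fin; zero; suc; toℕ; combine; remQuot; _↑ˡ_; _↑ʳ_)
open import Data.Fin.Properties as FP using (all?)
open import Data.Bool as B using (Bool; true; false; T; if_then_else_; _∧_; _∨_)
open import Data.Bool.Properties using (T-≡; T-∧; T-∨)
open import Data.Integer as ℤ using (ℤ; +_; -_)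
open import Data.Integer.Divisibility.Signed using (_∣_; _∣?_; ∣ᵤ⇒∣; ∣m∣n⇒∣m+n; ∣m∣n⇒∣m-n)
open import Data.Integer.Tactic.RingSolver using (solve-∀)
open import Data.List using (List; []; _∷_; length; lookup; map; foldr; allFin; tabulate)
import Data.List.Properties as LP
open import Data.List.Membership.Propositional using (_∈_)
open import Data.List.Membership.Propositional.Properties using (∈-allFin; ∈-lookup)
open import Data.List.Relation.Unary.Any as Any using (here; there)
open import Data.List.Relation.Unary.Any.Properties using (any⁺; any⁻)
import Data.List.Relation.Unary.All as All
open import Data.List.Relation.Unary.All.Properties using (¬Any⇒All¬; map⁻)
open import Data.List.Relation.Unary.AllPairs using (_∷_)
open import Data.List.Relation.Unary.Unique.Propositional using (Unique; [])
open import Algebra.Properties.Semiring.Sum ℕP.+-*-semiring using (sum-syntax; sum-cong-≗; *-distribˡ-sum)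
  renaming (sum to ∑)
open import Data.Product using (Σ; _×_; _,_; proj₁; proj₂; ∃)
open import Data.Sum as Sum using (_⊎_; inj₁; inj₂)
open import Data.Empty using (⊥-elim)
open import Function using (_∘_; id; case_of_; Equivalence)
open import Relation.Nullary using (Dec; yes; no)
open import Relation.Nullary.Decidable using (isYes; from-yes; toWitness; fromWitness; _→-dec_)
open import Relation.Binary.PropositionalEquality

Z₃ : Set
Z₃ = Fin 3

infixl 6 _⊕_
infix 8 ⊖_

_⊕_ : Z₃ → Z₃ → Z₃
_⊕_ = _⊕₃_

⊖_ : Z₃ → Z₃
⊖ zero = zero
⊖ suc zero = suc (suc zero)
⊖ suc (suc zero) = suc zero

⊕-identityˡ : ∀ a → zero ⊕ a ≡ a
⊕-identityˡ = from-yes (all? λ a → zero ⊕ a F.≟ a)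

⊕-identityʳ : ∀ a → a ⊕ zero ≡ a
⊕-identityʳ = from-yes (all? λ a → a ⊕ zero F.≟ a)

⊕-assoc : ∀ a b c → a ⊕ b ⊕ c ≡ a ⊕ (b ⊕ c)
⊕-assoc = from-yes (all? λ a → all? λ b → all? λ c → a ⊕ b ⊕ c F.≟ a ⊕ (b ⊕ c))

⊕-inverseʳ : ∀ a → a ⊕ ⊖ a ≡ zero
⊕-inverseʳ = from-yes (all? λ a → a ⊕ ⊖ a F.≟ zero)

⊕-inverseˡ : ∀ a → ⊖ a ⊕ a ≡ zero
⊕-inverseˡ = from-yes (all? λ a → ⊖ a ⊕ a F.≟ zero)

⊖-involutive : ∀ a → ⊖ ⊖ a ≡ a
⊖-involutive = from-yes (all? λ a → ⊖ ⊖ a F.≟ a)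

-- -(g + w) = -w + (-g + 0), the shape in which reversing a walk produces it.
⊖-reverse : ∀ g w → ⊖ w ⊕ (⊖ g ⊕ zero) ≡ ⊖ (g ⊕ w)
⊖-reverse = from-yes (all? λ g → all? λ w → ⊖ w ⊕ (⊖ g ⊕ zero) F.≟ ⊖ (g ⊕ w))

difference-zero : ∀ x g y → x ⊕ (g ⊕ ⊖ y) ≡ zero → y ≡ x ⊕ g
difference-zero = from-yes (all? λ x → all? λ g → all? λ y →
  (x ⊕ (g ⊕ ⊖ y) F.≟ zero) →-dec (y F.≟ x ⊕ g))

residue-zero : (a : Z₃) → + 3 ∣ + toℕ a → a ≡ zero
residue-zero = from-yes (all? λ (a : Z₃) → (+ 3 ∣? + toℕ a) →-dec (a F.≟ zero))

signedℤ : Bool → Z₃ → ℤ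
signedℤ d g = if d then + toℕ g else - (+ toℕ g)

signed₃ : Bool → Z₃ → Z₃
signed₃ d g = if d then g else ⊖ g

signed-residue : ∀ d g f → + 3 ∣ (signedℤ d g ℤ.+ + toℕ f) ℤ.- + toℕ (signed₃ d g ⊕ f)
signed-residue true = from-yes (all? λ g → all? λ f →
  + 3 ∣? (signedℤ true g ℤ.+ + toℕ f) ℤ.- + toℕ (signed₃ true g ⊕ f))
signed-residue false = from-yes (all? λ g → all? λ f →
  + 3 ∣? (signedℤ false g ℤ.+ + toℕ f) ℤ.- + toℕ (signed₃ false g ⊕ f))

χ : Bool → ℕ
χ b = if b then 1 else 0

χ-mono : ∀ {a b} → (a ≡ true → b ≡ true) → χ a ≤ χ b
χ-mono {false} _ = z≤n
χ-mono {true} a⇒b rewrite a⇒b refl = ℕP.≤-refl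

∧-true⁻ : ∀ {a b} → a ∧ b ≡ true → a ≡ true × b ≡ true
∧-true⁻ {true} b≡true = refl , b≡true

isYes-sound : ∀ {A : Set} (d : Dec A) → isYes d ≡ true → A
isYes-sound d h = toWitness (Equivalence.from T-≡ h)

isYes-complete : ∀ {A : Set} (d : Dec A) → A → isYes d ≡ true
isYes-complete d a = Equivalence.to T-≡ (fromWitness a)

sum-tabulate : ∀ {n} (f : Fin n → ℕ) → sum (tabulate f) ≡ ∑ f
sum-tabulate {zero} f = refl
sum-tabulate {suc n} f = cong (f zero ℕ.+_) (sum-tabulate (f ∘ suc))

countB≡∑ : ∀ {k} (f : Fin k → Bool) → countB f ≡ ∑ (χ ∘ f)
countB≡∑ {k} f = trans (cong sum (LP.map-tabulate id (χ ∘ f))) (sum-tabulate (χ ∘ f))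

∑-mono : ∀ {n} {f g : Fin n → ℕ} → (∀ i → f i ≤ g i) → ∑ f ≤ ∑ g
∑-mono {zero} _ = z≤n
∑-mono {suc n} f≤g = ℕP.+-mono-≤ (f≤g zero) (∑-mono (f≤g ∘ suc))

∑-split : ∀ m n (f : Fin (m + n) → ℕ) → ∑ f ≡ ∑ (λ i → f (i ↑ˡ n)) + ∑ (λ j → f (m ↑ʳ j))
∑-split zero n f = refl
∑-split (suc m) n f = trans (cong (f zero ℕ.+_) (∑-split m n (f ∘ suc))) (sym (ℕP.+-assoc (f zero) _ _))

∑-combine : ∀ m n (f : Fin (m * n) → ℕ) → ∑ f ≡ ∑[ i < m ] ∑[ t < n ] f (combine i t)
∑-combine zero n f = refl
∑-combine (suc m) n f =
  trans (∑-split n (m * n) f)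
        (cong (∑ (λ t → f (t ↑ˡ (m * n))) ℕ.+_) (∑-combine m n (λ x → f (n ↑ʳ x))))

countB-pairs : ∀ m n (f : Fin (m * n) → Bool) → countB f ≡ ∑[ i < m ] ∑[ t < n ] χ (f (combine i t))
countB-pairs m n f = trans (countB≡∑ f) (∑-combine m n (χ ∘ f))

one-hot : ∀ b (c : Z₃) → ∑[ t < 3 ] χ (b ∧ isYes (t F.≟ c)) ≡ χ b
one-hot false c = refl
one-hot true zero = refl
one-hot true (suc zero) = refl
one-hot true (suc (suc zero)) = refl

unique-lookup : ∀ {A B : Set} (f : A → B) (L : List A) → Unique (map f L) →
  ∀ i j → f (lookup L i) ≡ f (lookup L j) → i ≡ j
unique-lookup f (x ∷ L) (x∉L ∷ _) zero zero _ = refl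
unique-lookup f (x ∷ L) (x∉L ∷ _) zero (suc j) eq = ⊥-elim (All.lookup (map⁻ x∉L) (∈-lookup j) eq)
unique-lookup f (x ∷ L) (x∉L ∷ _) (suc i) zero eq = ⊥-elim (All.lookup (map⁻ x∉L) (∈-lookup i) (sym eq))
unique-lookup f (x ∷ L) (_ ∷ unique) (suc i) (suc j) eq = cong suc (unique-lookup f L unique i j eq)

map-lookup-allFin : ∀ {A B : Set} (f : A → B) (L : List A) → map (f ∘ lookup L) (allFin (length L)) ≡ map f L
map-lookup-allFin f L = begin
  map (f ∘ lookup L) (tabulate id) ≡⟨ LP.map-tabulate id (f ∘ lookup L) ⟩
  tabulate (f ∘ lookup L)          ≡⟨ LP.map-tabulate (lookup L) f ⟨
  map f (tabulate (lookup L))      ≡⟨ cong (map f) (LP.tabulate-lookup L) ⟩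
  map f L                          ∎
  where open ≡-Reasoning

incident : ∀ G (S : EdgeSet G) v → Fin (nE G) → Bool
incident G S v e = S e ∧ (isYes (src G e F.≟ v) ∨ isYes (tgt G e F.≟ v))

spans-elim : ∀ G (S : EdgeSet G) v → spans G S v ≡ true →
  ∃ λ e → S e ≡ true × (src G e ≡ v ⊎ tgt G e ≡ v)
spans-elim G S v h with Any.satisfied (any⁻ (incident G S v) (allFin (nE G)) (Equivalence.from T-≡ h))
... | e , e-incident with Equivalence.to (T-∧ {S e}) e-incident
...   | in-S , ends = e , Equivalence.to T-≡ in-S ,
                      Sum.map toWitness toWitness (Equivalence.to (T-∨ {isYes (src G e F.≟ v)}) ends)

spans-intro : ∀ G (S : EdgeSet G) v e → S e ≡ true → (src G e ≡ v ⊎ tgt G e ≡ v) → spans G S v ≡ true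
spans-intro G S v e in-S ends =
  Equivalence.to T-≡ (any⁺ (incident G S v) (Any.map (λ { refl → e-incident }) (∈-allFin e)))
  where
    e-incident : T (incident G S v e)
    e-incident = Equivalence.from (T-∧ {S e}) (Equivalence.from T-≡ in-S ,
      Equivalence.from (T-∨ {isYes (src G e F.≟ v)}) (Sum.map fromWitness fromWitness ends))

next-spec : ∀ {k} (i : Fin (suc k)) →
  toℕ (next i) ≡ suc (toℕ i) ⊎ (suc (toℕ i) ≡ suc k × toℕ (next i) ≡ 0)
next-spec {k} i with ℕP.m≤n⇒m<n∨m≡n (FP.toℕ<n i)
... | inj₁ not-last = inj₁ (trans (FP.toℕ-fromℕ< (m%n<n (suc (toℕ i)) (suc k))) (m<n⇒m%n≡m not-last))
... | inj₂ last = inj₂ (last , trans (FP.toℕ-fromℕ< (m%n<n (suc (toℕ i)) (suc k)))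
                                     (trans (cong (_% suc k) last) (n%n≡0 (suc k))))

next-involution : ∀ {k} (i j : Fin (suc k)) → j ≡ next i → i ≡ next j → i ≡ j ⊎ k ≡ 1
next-involution {k} i j j≡next-i i≡next-j =
  cases (next-spec-at j≡next-i (next-spec i)) (next-spec-at i≡next-j (next-spec j))
  where
    next-spec-at : ∀ {a b : Fin (suc k)} → b ≡ next a →
      toℕ (next a) ≡ suc (toℕ a) ⊎ (suc (toℕ a) ≡ suc k × toℕ (next a) ≡ 0) →
      toℕ b ≡ suc (toℕ a) ⊎ (suc (toℕ a) ≡ suc k × toℕ b ≡ 0)
    next-spec-at refl spec = spec
    no-2-cycle : ∀ a → a ≢ suc (suc a)
    no-2-cycle zero ()
    no-2-cycle (suc a) eq = no-2-cycle a (ℕP.suc-injective eq)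
    cases : toℕ j ≡ suc (toℕ i) ⊎ (suc (toℕ i) ≡ suc k × toℕ j ≡ 0) →
            toℕ i ≡ suc (toℕ j) ⊎ (suc (toℕ j) ≡ suc k × toℕ i ≡ 0) → i ≡ j ⊎ k ≡ 1
    cases (inj₁ j≡1+i) (inj₁ i≡1+j) = ⊥-elim (no-2-cycle (toℕ i) (trans i≡1+j (cong suc j≡1+i)))
    cases (inj₁ j≡1+i) (inj₂ (j-last , i≡0)) =
      inj₂ (trans (sym (ℕP.suc-injective j-last)) (trans j≡1+i (cong suc i≡0)))
    cases (inj₂ (i-last , j≡0)) (inj₁ i≡1+j) =
      inj₂ (trans (sym (ℕP.suc-injective i-last)) (trans i≡1+j (cong suc j≡0)))
    cases (inj₂ (_ , j≡0)) (inj₂ (_ , i≡0)) = inj₁ (FP.toℕ-injective (trans i≡0 (sym j≡0)))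

module Walks (Gγ : ColoredGraph) (S : EdgeSet (graph Gγ)) where

  private
    G : MultiGraph
    G = graph Gγ
    V E : Set
    V = Fin (nV G)
    E = Fin (nE G)

  open import Data.List.Membership.DecPropositional (F._≟_ {nV G}) using (_∈?_)

  Step : Set
  Step = E × Bool

  start end : Step → V
  start (e , true) = src G e
  start (e , false) = tgt G e
  end (e , true) = tgt G e
  end (e , false) = src G e

  weight : Step → Z₃
  weight s = signed₃ (proj₂ s) (γ Gγ (proj₁ s))

  weightℤ : Step → ℤ
  weightℤ s = signedℤ (proj₂ s) (γ Gγ (proj₁ s))

  Σ₃ : List Step → Z₃
  Σ₃ = foldr (λ s w → weight s ⊕ w) zero

  Σℤ : List Step → ℤ
  Σℤ L = foldr ℤ._+_ (+ 0) (map weightℤ L)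

  Σ₃-residue : ∀ L → + 3 ∣ Σℤ L ℤ.- + toℕ (Σ₃ L)
  Σ₃-residue [] = from-yes (+ 3 ∣? + 0)
  Σ₃-residue (s ∷ L) = subst (+ 3 ∣_) (regroup (weightℤ s) (Σℤ L) (+ toℕ (Σ₃ L)) _)
    (∣m∣n⇒∣m+n (signed-residue (proj₂ s) (γ Gγ (proj₁ s)) (Σ₃ L)) (Σ₃-residue L))
    where
      regroup : ∀ z Z F R → (z ℤ.+ F ℤ.- R) ℤ.+ (Z ℤ.- F) ≡ z ℤ.+ Z ℤ.- R
      regroup = solve-∀

  Σ₃-zero : ∀ L → + 3 ∣ Σℤ L → Σ₃ L ≡ zero
  Σ₃-zero L 3∣Σ = residue-zero (Σ₃ L)
    (subst (+ 3 ∣_) (cancel (Σℤ L) _) (∣m∣n⇒∣m-n 3∣Σ (Σ₃-residue L)))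
    where
      cancel : ∀ Z F → Z ℤ.- (Z ℤ.- F) ≡ F
      cancel = solve-∀

  data Walk : V → V → Set where
    []   : ∀ {a} → Walk a a
    cons : ∀ {b} (s : Step) → S (proj₁ s) ≡ true → Walk (end s) b → Walk (start s) b

  steps : ∀ {a b} → Walk a b → List Step
  steps [] = []
  steps (cons s _ p) = s ∷ steps p

  len : ∀ {a b} → Walk a b → ℕ
  len p = length (steps p)

  wsum : ∀ {a b} → Walk a b → Z₃
  wsum p = Σ₃ (steps p)

  infixr 5 _++ʷ_
  _++ʷ_ : ∀ {a b c} → Walk a b → Walk b c → Walk a c
  [] ++ʷ q = q
  cons s h p ++ʷ q = cons s h (p ++ʷ q)

  len-++ : ∀ {a b c} (p : Walk a b) (q : Walk b c) → len (p ++ʷ q) ≡ len p + len q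
  len-++ [] q = refl
  len-++ (cons s h p) q = cong suc (len-++ p q)

  wsum-++ : ∀ {a b c} (p : Walk a b) (q : Walk b c) → wsum (p ++ʷ q) ≡ wsum p ⊕ wsum q
  wsum-++ [] q = sym (⊕-identityˡ _)
  wsum-++ (cons s h p) q = trans (cong (weight s ⊕_) (wsum-++ p q)) (sym (⊕-assoc (weight s) _ _))

  reverse : ∀ {a b} → Walk a b → Walk b a
  reverse [] = []
  reverse (cons (e , true) h p) = reverse p ++ʷ cons (e , false) h []
  reverse (cons (e , false) h p) = reverse p ++ʷ cons (e , true) h []

  wsum-reverse : ∀ {a b} (p : Walk a b) → wsum (reverse p) ≡ ⊖ wsum p
  wsum-reverse [] = refl
  wsum-reverse (cons (e , true) h p) = begin
    wsum (reverse p ++ʷ cons (e , false) h [])  ≡⟨ wsum-++ (reverse p) _ ⟩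
    wsum (reverse p) ⊕ (⊖ γ Gγ e ⊕ zero)        ≡⟨ cong (_⊕ (⊖ γ Gγ e ⊕ zero)) (wsum-reverse p) ⟩
    ⊖ wsum p ⊕ (⊖ γ Gγ e ⊕ zero)                ≡⟨ ⊖-reverse (γ Gγ e) (wsum p) ⟩
    ⊖ (γ Gγ e ⊕ wsum p)                         ∎
    where open ≡-Reasoning
  wsum-reverse (cons (e , false) h p) = begin
    wsum (reverse p ++ʷ cons (e , true) h [])   ≡⟨ wsum-++ (reverse p) _ ⟩
    wsum (reverse p) ⊕ (γ Gγ e ⊕ zero)          ≡⟨ cong₂ (λ x y → x ⊕ (y ⊕ zero)) (wsum-reverse p)
                                                           (sym (⊖-involutive (γ Gγ e))) ⟩
    ⊖ wsum p ⊕ (⊖ ⊖ γ Gγ e ⊕ zero)              ≡⟨ ⊖-reverse (⊖ γ Gγ e) (wsum p) ⟩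
    ⊖ (⊖ γ Gγ e ⊕ wsum p)                       ∎
    where open ≡-Reasoning

  Simple : ∀ {a b} → Walk a b → Set
  Simple p = Unique (map start (steps p))

  record Detour {a b} (p : Walk a b) : Set where
    field
      {c}           : V
      q₁            : Walk a c
      loop          : Walk c c
      q₃            : Walk c b
      decomposition : p ≡ q₁ ++ʷ (loop ++ʷ q₃)
      loop-nonempty : 0 < len loop
      q₃-nonempty   : 0 < len q₃

    len-decomposition : len p ≡ len q₁ + (len loop + len q₃)
    len-decomposition = trans (cong len decomposition)
      (trans (len-++ q₁ (loop ++ʷ q₃)) (cong (len q₁ ℕ.+_) (len-++ loop q₃)))

    loop-shorter : len loop < len p
    loop-shorter = subst (len loop <_) (sym len-decomposition)
      (ℕP.<-≤-trans (ℕP.m<m+n (len loop) q₃-nonempty) (ℕP.m≤n+m _ (len q₁)))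

    bypass-shorter : len (q₁ ++ʷ q₃) < len p
    bypass-shorter = subst₂ _<_ (sym (len-++ q₁ q₃)) (sym len-decomposition)
      (ℕP.+-monoʳ-< (len q₁) (ℕP.m<n+m (len q₃) loop-nonempty))

    wsum-bypass : wsum loop ≡ zero → wsum p ≡ wsum (q₁ ++ʷ q₃)
    wsum-bypass loop-zero = begin
      wsum p                                 ≡⟨ cong wsum decomposition ⟩
      wsum (q₁ ++ʷ (loop ++ʷ q₃))            ≡⟨ wsum-++ q₁ _ ⟩
      wsum q₁ ⊕ wsum (loop ++ʷ q₃)           ≡⟨ cong (wsum q₁ ⊕_) (wsum-++ loop q₃) ⟩
      wsum q₁ ⊕ (wsum loop ⊕ wsum q₃)        ≡⟨ cong (λ w → wsum q₁ ⊕ (w ⊕ wsum q₃)) loop-zero ⟩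
      wsum q₁ ⊕ (zero ⊕ wsum q₃)             ≡⟨ cong (wsum q₁ ⊕_) (⊕-identityˡ _) ⟩
      wsum q₁ ⊕ wsum q₃                      ≡⟨ sym (wsum-++ q₁ q₃) ⟩
      wsum (q₁ ++ʷ q₃)                       ∎
      where open ≡-Reasoning

  split-at : ∀ {x b a} (p : Walk x b) → a ∈ map start (steps p) →
    Σ (Walk x a) λ r₁ → Σ (Walk a b) λ r₂ → 0 < len r₂ × p ≡ r₁ ++ʷ r₂
  split-at (cons s h p) (here refl) = [] , cons s h p , s≤s z≤n , refl
  split-at (cons s h p) (there a∈p) with split-at p a∈p
  ... | r₁ , r₂ , r₂-nonempty , p≡r₁r₂ = cons s h r₁ , r₂ , r₂-nonempty , cong (cons s h) p≡r₁r₂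

  simple-or-detour : ∀ {a b} (p : Walk a b) → Simple p ⊎ Detour p
  simple-or-detour [] = inj₁ []
  simple-or-detour (cons s h p) with simple-or-detour p
  ... | inj₂ d = inj₂ (record
        { q₁ = cons s h q₁ ; loop = loop ; q₃ = q₃ ; decomposition = cong (cons s h) decomposition
        ; loop-nonempty = loop-nonempty ; q₃-nonempty = q₃-nonempty })
    where open Detour d
  ... | inj₁ simple with start s ∈? map start (steps p)
  ...   | no s∉p = inj₁ (¬Any⇒All¬ _ s∉p ∷ simple)
  ...   | yes s∈p with split-at p s∈p
  ...     | r₁ , r₂ , r₂-nonempty , p≡r₁r₂ = inj₂ (record
        { q₁ = [] ; loop = cons s h r₁ ; q₃ = r₂ ; decomposition = cong (cons s h) p≡r₁r₂
        ; loop-nonempty = s≤s z≤n ; q₃-nonempty = r₂-nonempty })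

  empty-walk : ∀ {a b} (p : Walk a b) → len p ≡ 0 → a ≡ b
  empty-walk [] _ = refl

  start-first : ∀ {a b} (p : Walk a b) (i : Fin (len p)) → toℕ i ≡ 0 → start (lookup (steps p) i) ≡ a
  start-first (cons s h p) zero _ = refl

  end-last : ∀ {a b} (p : Walk a b) (i : Fin (len p)) → suc (toℕ i) ≡ len p → end (lookup (steps p) i) ≡ b
  end-last (cons s h p) zero i-last = empty-walk p (ℕP.suc-injective (sym i-last))
  end-last (cons s h p) (suc i) i-last = end-last p i (ℕP.suc-injective i-last)

  end-consecutive : ∀ {a b} (p : Walk a b) (i j : Fin (len p)) → toℕ j ≡ suc (toℕ i) →
    end (lookup (steps p) i) ≡ start (lookup (steps p) j)
  end-consecutive (cons s h p) zero (suc j) j≡1 = sym (start-first p j (ℕP.suc-injective j≡1))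
  end-consecutive (cons s h p) (suc i) (suc j) j≡1+i = end-consecutive p i j (ℕP.suc-injective j≡1+i)

  steps-in-S : ∀ {a b} (p : Walk a b) (i : Fin (len p)) → S (proj₁ (lookup (steps p) i)) ≡ true
  steps-in-S (cons s h p) zero = h
  steps-in-S (cons s h p) (suc i) = steps-in-S p i

  forward-ends : ∀ x → proj₂ x ≡ true → src G (proj₁ x) ≡ start x × tgt G (proj₁ x) ≡ end x
  forward-ends (e , true) refl = refl , refl

  backward-ends : ∀ x → proj₂ x ≡ false → src G (proj₁ x) ≡ end x × tgt G (proj₁ x) ≡ start x
  backward-ends (e , false) refl = refl , refl

  opposite-start : ∀ x y → proj₁ x ≡ proj₁ y → proj₂ x ≢ proj₂ y → start x ≡ end y
  opposite-start (e , true) (.e , true) refl opposite = ⊥-elim (opposite refl)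
  opposite-start (e , true) (.e , false) refl _ = refl
  opposite-start (e , false) (.e , true) refl _ = refl
  opposite-start (e , false) (.e , false) refl opposite = ⊥-elim (opposite refl)

  opposite-cancel : ∀ x y → proj₁ x ≡ proj₁ y → proj₂ x ≢ proj₂ y → weight x ⊕ weight y ≡ zero
  opposite-cancel (e , true) (.e , true) refl opposite = ⊥-elim (opposite refl)
  opposite-cancel (e , true) (.e , false) refl _ = ⊕-inverseʳ (γ Gγ e)
  opposite-cancel (e , false) (.e , true) refl _ = ⊕-inverseˡ (γ Gγ e)
  opposite-cancel (e , false) (.e , false) refl opposite = ⊥-elim (opposite refl)

  back-and-forth : (L : List Step) → length L ≡ 2 → (i j : Fin (length L)) →
    proj₁ (lookup L i) ≡ proj₁ (lookup L j) → proj₂ (lookup L i) ≢ proj₂ (lookup L j) → Σ₃ L ≡ zero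
  back-and-forth (x ∷ y ∷ []) _ zero zero _ opposite = ⊥-elim (opposite refl)
  back-and-forth (x ∷ y ∷ []) _ zero (suc zero) same opposite =
    trans (cong (weight x ⊕_) (⊕-identityʳ _)) (opposite-cancel x y same opposite)
  back-and-forth (x ∷ y ∷ []) _ (suc zero) zero same opposite =
    trans (cong (weight x ⊕_) (⊕-identityʳ _)) (opposite-cancel x y (sym same) (opposite ∘ sym))
  back-and-forth (x ∷ y ∷ []) _ (suc zero) (suc zero) _ opposite = ⊥-elim (opposite refl)

  -- A simple closed walk s · q whose colour sum is non-zero runs along a cycle of
  -- S: its vertices are distinct by simplicity, and an edge could only repeat in
  -- a back-and-forth walk of length 2, whose colour sum is 0.
  module CycleOfWalk (s : Step) (h : S (proj₁ s) ≡ true) (q : Walk (end s) (start s))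
                     (simple : Simple (cons s h q)) (nonzero : wsum (cons s h q) ≢ zero) where

    private
      L : List Step
      L = steps (cons s h q)

    vertex : Fin (suc (len q)) → V
    vertex i = start (lookup L i)

    closes : ∀ i → end (lookup L i) ≡ vertex (next i)
    closes i with next-spec i
    ... | inj₁ successor = end-consecutive (cons s h q) i (next i) successor
    ... | inj₂ (last , wraps) = trans (end-last (cons s h q) i last) (sym (start-first (cons s h q) (next i) wraps))

    vertex-injective : ∀ {i j} → vertex i ≡ vertex j → i ≡ j
    vertex-injective {i} {j} = unique-lookup start L simple i j

    edge-injective : ∀ {i j} → proj₁ (lookup L i) ≡ proj₁ (lookup L j) → i ≡ j
    edge-injective {i} {j} same with proj₂ (lookup L i) B.≟ proj₂ (lookup L j)
    ... | yes same-direction = vertex-injective (cong₂ (λ e d → start (e , d)) same same-direction)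
    ... | no opposite with next-involution i j
          (vertex-injective (trans (opposite-start _ _ (sym same) (opposite ∘ sym)) (closes i)))
          (vertex-injective (trans (opposite-start _ _ same opposite) (closes j)))
    ...   | inj₁ i≡j = i≡j
    ...   | inj₂ length≡2 = ⊥-elim (nonzero (back-and-forth L (cong suc length≡2) i j same opposite))

    cycle : Cycle G
    cycle = record
      { k = len q ; vs = vertex ; es = proj₁ ∘ lookup L ; dir = proj₂ ∘ lookup L
      ; vs-inj = vertex-injective ; es-inj = edge-injective
      ; fwd = λ i forward → let (at-src , at-tgt) = forward-ends (lookup L i) forward
                            in at-src , trans at-tgt (closes i)
      ; bwd = λ i backward → let (at-src , at-tgt) = backward-ends (lookup L i) backward
                             in trans at-src (closes i) , at-tgt }

    cycle-in-S : CycleIn {G} S cycle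
    cycle-in-S = steps-in-S (cons s h q)

    ρ-cycle : ρ Gγ cycle ≡ Σℤ L
    ρ-cycle = cong (foldr ℤ._+_ (+ 0)) (map-lookup-allFin weightℤ L)

  simple-balanced : TrivialImage Gγ S → ∀ {a} (p : Walk a a) → Simple p → wsum p ≡ zero
  simple-balanced trivial [] _ = refl
  simple-balanced trivial (cons s h q) simple with wsum (cons s h q) F.≟ zero
  ... | yes balanced = balanced
  ... | no nonzero = ⊥-elim (nonzero (Σ₃-zero (steps (cons s h q))
          (subst (+ 3 ∣_) ρ-cycle (∣ᵤ⇒∣ (trivial cycle cycle-in-S)))))
    where open CycleOfWalk s h q simple nonzero

  -- With trivial image, every closed walk has colour sum 0: cut out a detour,
  -- which is shorter and closed, and conclude for it and for the bypass.
  balanced : TrivialImage Gγ S → ∀ n {a} (p : Walk a a) → len p ≤ n → wsum p ≡ zero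
  balanced trivial zero [] _ = refl
  balanced trivial (suc n) p len≤ with simple-or-detour p
  ... | inj₁ simple = simple-balanced trivial p simple
  ... | inj₂ detour = trans (wsum-bypass (balanced trivial n loop (within loop-shorter)))
                            (balanced trivial n (q₁ ++ʷ q₃) (within bypass-shorter))
    where
      open Detour detour
      within : ∀ {l} → l < len p → l ≤ n
      within l< = ℕP.≤-pred (ℕP.<-≤-trans l< len≤)

  closed-balanced : TrivialImage Gγ S → ∀ {a b} → a ≡ b → (p : Walk a b) → wsum p ≡ zero
  closed-balanced trivial refl p = balanced trivial (len p) p ℕP.≤-refl

  -- State of a union–find pass after processing the edges es: every vertex is
  -- reached from its representative by a walk in S, and the endpoints of every
  -- processed edge of S share their representative.
  record Components (es : List E) : Set where
    field
      rep    : V → V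
      path   : ∀ v → Walk (rep v) v
      joined : ∀ e → e ∈ es → S e ≡ true → rep (src G e) ≡ rep (tgt G e)

  no-edges : Components []
  no-edges = record { rep = id ; path = λ _ → [] ; joined = λ _ () }

  -- Processing an edge u → v of S re-attaches v's component to u's
  -- representative, through the walk  path u · (u → v) · (path v)⁻¹.
  merge : ∀ {es} → Components es → (e : E) → S e ≡ true → Components (e ∷ es)
  merge {es} c e e∈S = record { rep = rep′ ; path = path′ ; joined = joined′ }
    where
      open Components c
      u v : V
      u = src G e
      v = tgt G e

      relink : ∀ w → Dec (rep w ≡ rep v) → Σ V λ r → Walk r w
      relink w (yes w~v) = rep u , path u ++ʷ cons (e , true) e∈S
                                     (reverse (path v) ++ʷ subst (λ r → Walk r w) w~v (path w))
      relink w (no _) = rep w , path w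

      rep′ : V → V
      rep′ w = proj₁ (relink w (rep w F.≟ rep v))

      path′ : ∀ w → Walk (rep′ w) w
      path′ w = proj₂ (relink w (rep w F.≟ rep v))

      moved : ∀ w → rep w ≡ rep v → rep′ w ≡ rep u
      moved w w~v with rep w F.≟ rep v
      ... | yes _ = refl
      ... | no w≁v = ⊥-elim (w≁v w~v)

      kept : ∀ w → rep w ≢ rep v → rep′ w ≡ rep w
      kept w w≁v with rep w F.≟ rep v
      ... | yes w~v = ⊥-elim (w≁v w~v)
      ... | no _ = refl

      -- Case splits use case_of_ rather than with, which would abstract the test inside rep′.
      u-stays : rep′ u ≡ rep u
      u-stays = case rep u F.≟ rep v of λ where
        (yes u~v) → moved u u~v
        (no u≁v) → kept u u≁v

      joined′ : ∀ e′ → e′ ∈ e ∷ es → S e′ ≡ true → rep′ (src G e′) ≡ rep′ (tgt G e′)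
      joined′ _ (here refl) _ = trans u-stays (sym (moved v refl))
      joined′ e′ (there e′∈es) e′∈S = case rep x F.≟ rep v of λ where
          (yes x~v) → trans (moved x x~v) (sym (moved y (trans (sym x~y) x~v)))
          (no x≁v) → trans (kept x x≁v) (trans x~y (sym (kept y (x≁v ∘ trans x~y))))
        where
          x y : V
          x = src G e′
          y = tgt G e′
          x~y : rep x ≡ rep y
          x~y = joined e′ e′∈es e′∈S

  add-edge : ∀ {es} → Components es → (e : E) → Components (e ∷ es)
  add-edge {es} c e with S e in e-in-S
  ... | true = merge c e e-in-S
  ... | false = record { rep = rep ; path = path ; joined = joined′ }
    where
      open Components c
      joined′ : ∀ e′ → e′ ∈ e ∷ es → S e′ ≡ true → rep (src G e′) ≡ rep (tgt G e′)
      joined′ _ (here refl) e∈S = ⊥-elim (false≢true (trans (sym e-in-S) e∈S))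
        where
          false≢true : false ≢ true
          false≢true ()
      joined′ e′ (there e′∈es) e′∈S = joined e′ e′∈es e′∈S

  components : (es : List E) → Components es
  components [] = no-edges
  components (e ∷ es) = add-edge (components es) e

  Potential : (V → Z₃) → Set
  Potential φ = ∀ e → S e ≡ true → φ (tgt G e) ≡ φ (src G e) ⊕ γ Gγ e

  -- With trivial image, S has a potential: φ v is the colour sum of the walk to v
  -- from its representative.  For an edge e of S, whose endpoints share the
  -- representative, these walks and e form a closed walk, which balances.
  potential : TrivialImage Gγ S → Σ (V → Z₃) Potential
  potential trivial = φ , compatible
    where
      open Components (components (allFin (nE G)))
      φ : V → Z₃
      φ w = wsum (path w)
      compatible : Potential φ
      compatible e e∈S = difference-zero (φ u) (γ Gγ e) (φ v) (begin
        φ u ⊕ (γ Gγ e ⊕ ⊖ φ v)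
          ≡⟨ cong (λ x → φ u ⊕ (γ Gγ e ⊕ x)) (wsum-reverse (path v)) ⟨
        φ u ⊕ (γ Gγ e ⊕ wsum (reverse (path v)))
          ≡⟨ wsum-++ (path u) around ⟨
        wsum (path u ++ʷ around)
          ≡⟨ closed-balanced trivial (joined e (∈-allFin e) e∈S) (path u ++ʷ around) ⟩
        zero ∎)
        where
          open ≡-Reasoning
          u v : V
          u = src G e
          v = tgt G e
          around : Walk u (rep v)
          around = cons (e , true) e∈S (reverse (path v))

module Lifts (Gγ : ColoredGraph) where

  private
    G D : MultiGraph
    G = graph Gγ
    D = development Gγ
    V : Set
    V = Fin (nV G)

  base : Fin (nE D) → Fin (nE G)
  base x = proj₁ (remQuot {nE G} 3 x)

  level : Fin (nE D) → Z₃
  level x = proj₂ (remQuot {nE G} 3 x)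

  base-level-combine : ∀ e t → (base (combine e t) , level (combine e t)) ≡ (e , t)
  base-level-combine e t = FP.remQuot-combine e t

  LiesOver : EdgeSet D → EdgeSet G → Set
  LiesOver T S = ∀ x → T x ≡ true → S (base x) ≡ true

  spanned-over : ∀ {T S} → LiesOver T S → ∀ v t → spans D T (combine v t) ≡ true → spans G S v ≡ true
  spanned-over {T} {S} T-over-S v t spanned with spans-elim D T (combine v t) spanned
  ... | x , x∈T , inj₁ at-src =
    spans-intro G S v (base x) (T-over-S x x∈T) (inj₁ (FP.combine-injectiveˡ _ _ v t at-src))
  ... | x , x∈T , inj₂ at-tgt =
    spans-intro G S v (base x) (T-over-S x x∈T) (inj₂ (FP.combine-injectiveˡ _ _ v t at-tgt))

  edges-by-copy : (T : EdgeSet D) → mSub {D} T ≡ ∑[ e < nE G ] ∑[ t < 3 ] χ (T (combine e t))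
  edges-by-copy T = countB-pairs (nE G) 3 T

  vertices-by-copy : (T : EdgeSet D) → nSpan D T ≡ ∑[ v < nV G ] ∑[ t < 3 ] χ (spans D T (combine v t))
  vertices-by-copy T = countB-pairs (nV G) 3 (spans D T)

  fullLift : EdgeSet G → EdgeSet D
  fullLift S x = S (base x)

  fullLift-edges : ∀ S → mSub {D} (fullLift S) ≡ 3 * mSub {G} S
  fullLift-edges S = begin
    mSub {D} (fullLift S)                                 ≡⟨ edges-by-copy (fullLift S) ⟩
    ∑[ e < nE G ] ∑[ t < 3 ] χ (S (base (combine e t)))   ≡⟨ sum-cong-≗ (λ e → sum-cong-≗ λ t →
                                                               cong (χ ∘ S ∘ proj₁) (base-level-combine e t)) ⟩
    ∑[ e < nE G ] (3 * χ (S e))                           ≡⟨ *-distribˡ-sum 3 (χ ∘ S) ⟨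
    3 * ∑ (χ ∘ S)                                         ≡⟨ cong (3 *_) (countB≡∑ S) ⟨
    3 * mSub {G} S                                        ∎
    where open ≡-Reasoning

  fullLift-vertices : ∀ S → nSpan D (fullLift S) ≤ 3 * nSpan G S
  fullLift-vertices S = begin
    nSpan D (fullLift S)                                          ≡⟨ vertices-by-copy (fullLift S) ⟩
    ∑[ v < nV G ] ∑[ t < 3 ] χ (spans D (fullLift S) (combine v t)) ≤⟨ ∑-mono (λ v → ∑-mono λ t →
                                                                       χ-mono (spanned-over {S = S} (λ _ → id) v t)) ⟩
    ∑[ v < nV G ] (3 * χ (spans G S v))                           ≡⟨ *-distribˡ-sum 3 (χ ∘ spans G S) ⟨
    3 * ∑ (χ ∘ spans G S)                                         ≡⟨ cong (3 *_) (countB≡∑ (spans G S)) ⟨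
    3 * nSpan G S                                                 ∎
    where open ℕP.≤-Reasoning

  fullLift-bound : LamanSparse D → ∀ S → NonEmpty {G} S → mSub {G} S + 1 ≤ 2 * nSpan G S
  fullLift-bound laman S (e , e∈S) = ℕP.*-cancelˡ-≤ 3 (begin
    3 * (mSub {G} S + 1)        ≡⟨ ℕP.*-distribˡ-+ 3 (mSub {G} S) 1 ⟩
    3 * mSub {G} S + 3          ≡⟨ cong (ℕ._+ 3) (fullLift-edges S) ⟨
    mSub {D} (fullLift S) + 3   ≤⟨ laman (fullLift S) (combine e zero , copy∈lift) ⟩
    2 * nSpan D (fullLift S)    ≤⟨ ℕP.*-monoʳ-≤ 2 (fullLift-vertices S) ⟩
    2 * (3 * nSpan G S)         ≡⟨ ℕP.*-assoc 2 3 (nSpan G S) ⟨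
    6 * nSpan G S               ≡⟨ ℕP.*-assoc 3 2 (nSpan G S) ⟩
    3 * (2 * nSpan G S)         ∎)
    where
      open ℕP.≤-Reasoning
      copy∈lift : fullLift S (combine e zero) ≡ true
      copy∈lift = trans (cong (S ∘ proj₁) (base-level-combine e zero)) e∈S

  sheet : (V → Z₃) → EdgeSet G → EdgeSet D
  sheet φ S x = S (base x) ∧ isYes (level x F.≟ φ (src G (base x)))

  sheet-combine : ∀ φ S e t → sheet φ S (combine e t) ≡ S e ∧ isYes (t F.≟ φ (src G e))
  sheet-combine φ S e t =
    cong (λ (e′ , t′) → S e′ ∧ isYes (t′ F.≟ φ (src G e′))) (base-level-combine e t)

  sheet-edges : ∀ φ S → mSub {D} (sheet φ S) ≡ mSub {G} S
  sheet-edges φ S = begin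
    mSub {D} (sheet φ S)                                        ≡⟨ edges-by-copy (sheet φ S) ⟩
    ∑[ e < nE G ] ∑[ t < 3 ] χ (sheet φ S (combine e t))        ≡⟨ sum-cong-≗ (λ e →
      trans (sum-cong-≗ (λ t → cong χ (sheet-combine φ S e t))) (one-hot (S e) (φ (src G e)))) ⟩
    ∑ (χ ∘ S)                                                   ≡⟨ countB≡∑ S ⟨
    mSub {G} S                                                  ∎
    where open ≡-Reasoning

  on-sheet : ∀ φ S → Walks.Potential Gγ S φ →
    ∀ v t → spans D (sheet φ S) (combine v t) ≡ true → t ≡ φ v
  on-sheet φ S potential v t spanned with spans-elim D (sheet φ S) (combine v t) spanned
  ... | x , x∈sheet , ends = endpoint ends
    where
      e : Fin (nE G)
      e = base x
      e∈S : S e ≡ true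
      e∈S = proj₁ (∧-true⁻ x∈sheet)
      level≡φ : level x ≡ φ (src G e)
      level≡φ = isYes-sound (level x F.≟ φ (src G e)) (proj₂ (∧-true⁻ x∈sheet))
      endpoint : src D x ≡ combine v t ⊎ tgt D x ≡ combine v t → t ≡ φ v
      endpoint (inj₁ at-src) with FP.combine-injective _ _ v t at-src
      ... | src≡v , level≡t = trans (sym level≡t) (trans level≡φ (cong φ src≡v))
      endpoint (inj₂ at-tgt) with FP.combine-injective _ _ v t at-tgt
      ... | tgt≡v , level+γ≡t = begin
        t                          ≡⟨ level+γ≡t ⟨
        level x ⊕ γ Gγ e           ≡⟨ cong (_⊕ γ Gγ e) level≡φ ⟩
        φ (src G e) ⊕ γ Gγ e       ≡⟨ potential e e∈S ⟨
        φ (tgt G e)                ≡⟨ cong φ tgt≡v ⟩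
        φ v                        ∎
        where open ≡-Reasoning

  sheet-vertices : ∀ φ S → Walks.Potential Gγ S φ → nSpan D (sheet φ S) ≤ nSpan G S
  sheet-vertices φ S potential = begin
    nSpan D (sheet φ S)                                              ≡⟨ vertices-by-copy (sheet φ S) ⟩
    ∑[ v < nV G ] ∑[ t < 3 ] χ (spans D (sheet φ S) (combine v t))   ≤⟨ ∑-mono (λ v → ∑-mono λ t → χ-mono
                                                                          (spanned-at-level v t)) ⟩
    ∑[ v < nV G ] ∑[ t < 3 ] χ (spans G S v ∧ isYes (t F.≟ φ v))     ≡⟨ sum-cong-≗ (λ v → one-hot _ (φ v)) ⟩
    ∑ (χ ∘ spans G S)                                                ≡⟨ countB≡∑ (spans G S) ⟨
    nSpan G S                                                        ∎
    where
      open ℕP.≤-Reasoning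
      spanned-at-level : ∀ v t → spans D (sheet φ S) (combine v t) ≡ true →
                         spans G S v ∧ isYes (t F.≟ φ v) ≡ true
      spanned-at-level v t spanned = cong₂ _∧_ (spanned-over {S = S} (λ _ → proj₁ ∘ ∧-true⁻) v t spanned)
        (isYes-complete (t F.≟ φ v) (on-sheet φ S potential v t spanned))

  sheet-bound : LamanSparse D → ∀ S → NonEmpty {G} S → ∀ φ → Walks.Potential Gγ S φ →
    mSub {G} S + 3 ≤ 2 * nSpan G S
  sheet-bound laman S (e , e∈S) φ potential = begin
    mSub {G} S + 3                  ≡⟨ cong (ℕ._+ 3) (sheet-edges φ S) ⟨
    mSub {D} (sheet φ S) + 3        ≤⟨ laman (sheet φ S) (combine e (φ (src G e)) , copy∈sheet) ⟩
    2 * nSpan D (sheet φ S)         ≤⟨ ℕP.*-monoʳ-≤ 2 (sheet-vertices φ S potential) ⟩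
    2 * nSpan G S                   ∎
    where
      open ℕP.≤-Reasoning
      copy∈sheet : sheet φ S (combine e (φ (src G e))) ≡ true
      copy∈sheet = trans (sheet-combine φ S e _)
        (cong₂ _∧_ e∈S (isYes-complete (φ (src G e) F.≟ φ (src G e)) refl))

mainTheorem13 : (Gγ : ColoredGraph) → LamanSparse (development Gγ) → ConeLamanSparse Gγ
mainTheorem13 Gγ laman S nonempty = trivial-bound , λ _ → fullLift-bound laman S nonempty
  where
    open Lifts Gγ
    open Walks Gγ S using (potential)
    trivial-bound : TrivialImage Gγ S → mSub {graph Gγ} S + 3 ≤ 2 * nSpan (graph Gγ) S
    trivial-bound trivial = let (φ , φ-potential) = potential trivial
                            in sheet-bound laman S nonempty φ φ-potential
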